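{- (A.4 for $\mathcal{E}_2$.) Let $n<\omega$, $a\in\mathcal{AR}_n$, $X\in\mathcal{E}_2$ with $a\subseteq X$, and $\mathcal{H}\subseteq\mathcal{AR}_{n+1}$. Then there is $Y\in[\mathrm{depth}_X(a),X]$ such that either $r_{n+1}[a,Y]\subseteq\mathcal{H}$ or $r_{n+1}[a,Y]\cap\mathcal{H}=\emptyset$.
   Context: The space $\mathcal{E}_2$: let $\omega^{\not\downarrow\le 2}$ be the non-decreasing sequences of naturals of length $\le 2$ (including $()$), $\omega^{\not\downarrow 2}$ those of length $2$. Well-order $\omega^{\not\downarrow\le 2}$ by $\prec$: $()$ least; for nonempty $(j_0,\dots,j_{p-1}),(l_0,\dots,l_{q-1})$, $\prec$ holds iff $j_{p-1}<l_{q-1}$, or $j_{p-1}=l_{q-1}$ and the first is lexicographically below the second (proper initial segments count as below). $\vec j_m$ is its $m$-th element, $m_{\vec l}$ the index of $\vec l$, $\vec i_n$ the $n$-th element of $\omega^{\not\downarrow 2}$. $\mathbb{W}_2(\vec j)=\{m_{\vec j\restriction q}:1\le q\le|\vec j|\}$, $\widehat{\mathbb{W}}_2=\{\mathbb{W}_2(\vec j)\}$. An $\mathcal{E}_2$-tree is $\hat X:\omega^{\not\downarrow\le 2}\to\widehat{\mathbb{W}}_2$ with (i) $|\hat X(\vec j_m)|=|\vec j_m|$; (ii) $\max\hat X(\vec j_m)<\max\hat X(\vec j_{m+1})$ for $m\ge1$; (iii) $\hat X(\vec j_m)$ is a proper initial segment of $\hat X(\vec j_n)$ iff $\vec j_m$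 is a proper initial segment of $\vec j_n$. $\mathcal{E}_2$ consists of the restrictions $X=\hat X\restriction\omega^{\not\downarrow 2}$, identified with their ranges. $Y\le X$ iff $Y\subseteq X$. $r_n(X)=\{X(\vec i_p):p<n\}$; $\mathcal{AR}_n=\{r_n(X):X\in\mathcal{E}_2\}$. $a\sqsubset b$ means $a=r_m(b)$ for some $m<|b|$. $[c,B]=\{A\le B:r_m(A)=c\text{ for some }m\}$; $\mathrm{depth}_X(a)$ is the least $d$ with $a\subseteq r_d(X)$ and $[\mathrm{depth}_X(a),X]=[r_d(X),X]$. $r_{n+1}[a,Y]=\{b\in\mathcal{AR}_{n+1}:a\sqsubset b,\ b\subseteq Y\}$. -}

module Defs where

open import Data.Nat using (ℕ; zero; suc; _+_; _≤_; _<_; _≤?_; _<ᵇ_; _≡ᵇ_; _⊔_)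
open import Data.Bool using (Bool; true; false; _∧_; _∨_; if_then_else_)
open import Data.List using (List; []; _∷_; _++_; length; map; upTo; concatMap; filterᵇ; findᵇ; take; foldr)
open import Data.List.Relation.Unary.All using (All)
open import Data.List.Membership.Propositional using (_∈_)
open import Data.Maybe using (Maybe; just; nothing)
open import Data.Product using (Σ; _×_; _,_; ∃)
open import Data.Sum using (_⊎_)
open import Relation.Nullary using (¬_; yes; no)
open import Relation.Binary.PropositionalEquality using (_≡_)

-- ω^{↓≤2}: non-decreasing sequences of naturals of length ≤ 2.
-- The proof j ≤ k is irrelevant, so (j,k) is determined by j and k.

data NSeq : Set where
  ε   : NSeq
  one : ℕ → NSeq
  two : (j k : ℕ) → .(j ≤ k) → NSeq

toList : NSeq → List ℕ
toList ε           = []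
toList (one j)     = j ∷ []
toList (two j k _) = j ∷ k ∷ []

len : NSeq → ℕ
len s = length (toList s)

isTwo : NSeq → Bool
isTwo (two _ _ _) = true
isTwo _           = false

-- last element (only used for nonempty sequences; 0 for ())
lastE : NSeq → ℕ
lastE ε           = 0
lastE (one j)     = j
lastE (two _ k _) = k

lexLt : List ℕ → List ℕ → Bool
lexLt []       []       = false
lexLt []       (_ ∷ _)  = true
lexLt (_ ∷ _)  []       = false
lexLt (x ∷ xs) (y ∷ ys) = (x <ᵇ y) ∨ ((x ≡ᵇ y) ∧ lexLt xs ys)

_≺ᵇ_ : NSeq → NSeq → Bool
ε ≺ᵇ ε = false
ε ≺ᵇ _ = true
_ ≺ᵇ ε = false
s ≺ᵇ t = (lastE s <ᵇ lastE t) ∨ ((lastE s ≡ᵇ lastE t) ∧ lexLt (toList s) (toList t))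

-- all elements of ω^{↓≤2} whose entries are ≤ K
-- (this contains every t with t ≺ s whenever lastE s ≤ K)
mkTwo : ℕ → ℕ → List NSeq
mkTwo j k with j ≤? k
... | yes p = two j k p ∷ []
... | no _  = []

allUpTo : ℕ → List NSeq
allUpTo K = ε ∷ concatMap (λ k → one k ∷ concatMap (λ j → mkTwo j k) (upTo (suc k))) (upTo (suc K))

count : {A : Set} → (A → Bool) → List A → ℕ
count p xs = length (filterᵇ p xs)

-- m_{l}: the index of l in (ω^{↓≤2}, ≺) = number of ≺-predecessors
idx : NSeq → ℕ
idx s = count (λ t → t ≺ᵇ s) (allUpTo (lastE s))

-- \vec j_m: the m-th element of (ω^{↓≤2}, ≺)   (its entries are ≤ m)
jvec : ℕ → NSeq
jvec m with findᵇ (λ s → idx s ≡ᵇ m) (allUpTo m)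
... | just s  = s
... | nothing = ε

idx2 : NSeq → ℕ
idx2 s = count (λ t → isTwo t ∧ (t ≺ᵇ s)) (allUpTo (lastE s))

-- \vec i_n: the n-th element of ω^{↓2}   (its entries are ≤ n)
ivec : ℕ → NSeq
ivec n with findᵇ (λ s → isTwo s ∧ (idx2 s ≡ᵇ n)) (allUpTo n)
... | just s  = s
... | nothing = ε

restr : NSeq → ℕ → NSeq
restr s           zero          = ε
restr ε           (suc _)       = ε
restr (one j)     (suc _)       = one j
restr (two j k p) (suc zero)    = one j
restr (two j k p) (suc (suc _)) = two j k p

W2 : NSeq → List ℕ
W2 s = map (λ q → idx (restr s (suc q))) (upTo (len s))

maxL : List ℕ → ℕ
maxL = foldr _⊔_ 0

ProperInitSeg : List ℕ → List ℕ → Set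
ProperInitSeg A B =
  (∀ x → x ∈ A → x ∈ B) ×
  (∃ λ y → y ∈ B × ¬ (y ∈ A)) ×
  (∀ x y → x ∈ A → y ∈ B → ¬ (y ∈ A) → x < y)

ProperPrefix : NSeq → NSeq → Set
ProperPrefix s t = Σ ℕ λ h → Σ (List ℕ) λ rest → toList s ++ (h ∷ rest) ≡ toList t

record E2Tree : Set where
  field
    fun   : NSeq → List ℕ
    inW   : ∀ s → Σ NSeq λ l → fun s ≡ W2 l
    lenOK : ∀ s → length (fun s) ≡ len s
    incr  : ∀ m → 1 ≤ m → maxL (fun (jvec m)) < maxL (fun (jvec (suc m)))
    segTo : ∀ s t → ProperInitSeg (fun s) (fun t) → ProperPrefix s t
    segFr : ∀ s t → ProperPrefix s t → ProperInitSeg (fun s) (fun t)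
open E2Tree public

-- X = \hat X ↾ ω^{↓2};  X(\vec i_p)
at : E2Tree → ℕ → List ℕ
at X p = fun X (ivec p)

_∈E_ : List ℕ → E2Tree → Set
x ∈E X = Σ ℕ λ p → x ≡ at X p

_≤E_ : E2Tree → E2Tree → Set
Y ≤E X = ∀ p → at Y p ∈E X

r : ℕ → E2Tree → List (List ℕ)
r n X = map (at X) (upTo n)

AR : ℕ → List (List ℕ) → Set
AR n a = Σ E2Tree λ X → a ≡ r n X

_⊆E_ : List (List ℕ) → E2Tree → Set
a ⊆E X = All (λ x → x ∈E X) a

_⊆L_ : List (List ℕ) → List (List ℕ) → Set
a ⊆L b = All (λ x → x ∈ b) a

_⊏_ : List (List ℕ) → List (List ℕ) → Set
a ⊏ b = Σ ℕ λ m → m < length b × a ≡ take m b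

_∈[_,_] : E2Tree → List (List ℕ) → E2Tree → Set
A ∈[ c , B ] = A ≤E B × Σ ℕ λ m → r m A ≡ c

IsDepth : E2Tree → List (List ℕ) → ℕ → Set
IsDepth X a d = a ⊆L r d X × (∀ d' → a ⊆L r d' X → d ≤ d')

InR : ℕ → List (List ℕ) → E2Tree → List (List ℕ) → Set
InR k a Y b = AR k b × a ⊏ b × b ⊆E Y

-- Let d be the depth of a.  Every b ∈ r_{n+1}[a,Y] is a⌢y with y = Z(iₙ) for a tree Z with
-- r_n(Z) = a; colour y by whether a⌢y ∈ 𝓗 (this is where excluded middle enters).  The tree Y
-- is X composed with a self-embedding of (ω^{↓≤2}, ≺) that preserves ≺ and prefixes, fixes all
-- sequences up to the last one listed in r_d(X), and sends the other sequences ending in k to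
-- sequences ending in F(3k), F(3k+1) or F(3k+2), for an increasing F chosen above everything
-- kept.  Write iₙ = (j,k).  If j < k, the head of y is the X-value of a node u determined by a,
-- so y = X(u, F(i)) and the infinite pigeonhole principle makes the colour constant.  If j = k,
-- the head of y exceeds every value recorded in a, so y = X(F(p), F(q)) with p < q, and
-- Ramsey's theorem for pairs makes the colour constant.

module Submission where

open import Defs
open import Level using (0ℓ)
open import Axiom.ExcludedMiddle using (ExcludedMiddle)
open import Data.Bool using (Bool; true; false; T; _∧_; _∨_; if_then_else_)
open import Data.Bool.Properties using (∨-identityʳ; ∧-zeroʳ; ¬-not)
open import Data.Empty using (⊥-elim-irr)
open import Data.List using (List; []; _∷_; _++_; [_]; _∷ʳ_; length; map; upTo; applyUpTo; concatMap; filterᵇ; findᵇ; take)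
open import Data.List.Properties
  using (++-identityʳ; ++-assoc; length-++; length-map; length-upTo; length-take; map-++; filter-++; concatMap-++;
         upTo-∷ʳ; applyUpTo-∷ʳ; ∷ʳ-injective; ≡-dec)
open import Data.List.Membership.Propositional using (_∈_)
open import Data.List.Membership.Propositional.Properties using (∈-map⁻; ∈-map⁺; ∈-upTo⁻; ∈-upTo⁺; ∈-filter⁻; ∈-++⁻)
open import Data.List.Relation.Unary.All using (All)
import Data.List.Relation.Unary.All as All
open import Data.List.Relation.Unary.All.Properties using (++⁻ʳ)
open import Data.List.Relation.Unary.Any using (here; there)
open import Data.List.Relation.Binary.Permutation.Propositional using (_↭_; ↭-reflexive; ↭-sym; module PermutationReasoning)
open import Data.List.Relation.Binary.Permutation.Propositional.Properties using (↭-length; filter-↭; ++⁺; shift; ∈-resp-↭)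
open import Data.Maybe using (just)
open import Data.Nat
open import Data.Nat.Properties
open import Data.List.Membership.DecPropositional (≡-dec _≟_) using (_∈?_)
open import Data.Product using (Σ; ∃-syntax; _×_; _,_; proj₁; proj₂)
open import Data.Sum using (_⊎_; inj₁; inj₂)
open import Data.Unit using (⊤; tt)
open import Function using (_∘_)
open import Relation.Binary.Definitions using (tri<; tri≈; tri>)
open import Relation.Binary.PropositionalEquality hiding ([_])
open import Relation.Nullary using (¬_; Dec; yes; no; does; contradiction; Reflects; ofʸ; ofⁿ; T?; recompute)
open import Relation.Nullary.Decidable using (decidable-stable)
open import Relation.Nullary.Reflects using (fromEquivalence)

recompute≤ : ∀ {m n} → .(m ≤ n) → m ≤ n
recompute≤ {m} {n} = recompute (m ≤? n)

reflects-true : ∀ {P : Set} {b} → Reflects P b → P → b ≡ true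
reflects-true (ofʸ _)  _ = refl
reflects-true (ofⁿ ¬p) p = contradiction p ¬p

reflects-false : ∀ {P : Set} {b} → Reflects P b → ¬ P → b ≡ false
reflects-false (ofʸ p) ¬p = contradiction p ¬p
reflects-false (ofⁿ _) _  = refl

≡ᵇ-reflects-≡ : ∀ m n → Reflects (m ≡ n) (m ≡ᵇ n)
≡ᵇ-reflects-≡ m n = fromEquivalence (≡ᵇ⇒≡ m n) (≡⇒≡ᵇ m n)

<ᵇ-true : ∀ {m n} → m < n → (m <ᵇ n) ≡ true
<ᵇ-true {m} {n} = reflects-true (<ᵇ-reflects-< m n)

<ᵇ-false : ∀ {m n} → m ≮ n → (m <ᵇ n) ≡ false
<ᵇ-false {m} {n} = reflects-false (<ᵇ-reflects-< m n)

≡ᵇ-true : ∀ {m n} → m ≡ n → (m ≡ᵇ n) ≡ true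
≡ᵇ-true {m} {n} = reflects-true (≡ᵇ-reflects-≡ m n)

≡ᵇ-false : ∀ {m n} → m ≢ n → (m ≡ᵇ n) ≡ false
≡ᵇ-false {m} {n} = reflects-false (≡ᵇ-reflects-≡ m n)

+-<ᵇ-cancelˡ : ∀ b m n → (b + m <ᵇ b + n) ≡ (m <ᵇ n)
+-<ᵇ-cancelˡ zero    m n = refl
+-<ᵇ-cancelˡ (suc b) m n = +-<ᵇ-cancelˡ b m n

module _ {A : Set} where

  count-++ : (p : A → Bool) (xs ys : List A) → count p (xs ++ ys) ≡ count p xs + count p ys
  count-++ p xs ys = trans (cong length (filter-++ (T? ∘ p) xs ys)) (length-++ (filterᵇ p xs))

  count-cong : {p q : A → Bool} → (∀ x → p x ≡ q x) → (xs : List A) → count p xs ≡ count q xs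
  count-cong             p≗q []       = refl
  count-cong {p} {q} p≗q (x ∷ xs) with p x | q x | p≗q x
  ... | true  | true  | _ = cong suc (count-cong p≗q xs)
  ... | false | false | _ = count-cong p≗q xs

  count-∧ : (p q : A → Bool) (xs : List A) → count (λ x → p x ∧ q x) xs ≡ count q (filterᵇ p xs)
  count-∧ p q []       = refl
  count-∧ p q (x ∷ xs) with p x
  ... | false = count-∧ p q xs
  ... | true with q x
  ...   | true  = cong suc (count-∧ p q xs)
  ...   | false = count-∧ p q xs

  count-map : {B : Set} (p : B → Bool) (f : A → B) (xs : List A) → count p (map f xs) ≡ count (p ∘ f) xs
  count-map p f []       = refl
  count-map p f (x ∷ xs) with p (f x)
  ... | true  = cong suc (count-map p f xs)
  ... | false = count-map p f xs

  count-↭ : (p : A → Bool) {xs ys : List A} → xs ↭ ys → count p xs ≡ count p ys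
  count-↭ p xs↭ys = ↭-length (filter-↭ (T? ∘ p) xs↭ys)

  findᵇ-just : (p : A → Bool) {x : A} {xs : List A} → x ∈ xs → T (p x) →
    ∃[ y ] findᵇ p xs ≡ just y × T (p y)
  findᵇ-just p {xs = z ∷ xs} x∈ px with p z in pz
  ... | true = z , refl , subst T (sym pz) tt
  findᵇ-just p (here refl) px | false = contradiction (subst T pz px) λ ()
  findᵇ-just p (there x∈)  px | false = findᵇ-just p x∈ px

count-<ᵇ-upTo : ∀ m n → count (_<ᵇ m) (upTo n) ≡ m ⊓ n
count-<ᵇ-upTo m zero    = sym (⊓-zeroʳ m)
count-<ᵇ-upTo m (suc n) = begin
  count (_<ᵇ m) (upTo (suc n))                  ≡⟨ cong (count (_<ᵇ m)) (upTo-∷ʳ n) ⟨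
  count (_<ᵇ m) (upTo n ++ [ n ])               ≡⟨ count-++ (_<ᵇ m) (upTo n) [ n ] ⟩
  count (_<ᵇ m) (upTo n) + count (_<ᵇ m) [ n ]  ≡⟨ cong (_+ count (_<ᵇ m) [ n ]) (count-<ᵇ-upTo m n) ⟩
  m ⊓ n + count (_<ᵇ m) [ n ]                   ≡⟨ last-step (n <? m) ⟩
  m ⊓ suc n                                     ∎
  where
  open ≡-Reasoning
  last-step : Dec (n < m) → m ⊓ n + count (_<ᵇ m) [ n ] ≡ m ⊓ suc n
  last-step (yes n<m) rewrite <ᵇ-true n<m
    | m≥n⇒m⊓n≡n (<⇒≤ n<m) | m≥n⇒m⊓n≡n n<m = +-comm n 1
  last-step (no n≮m) rewrite <ᵇ-false n≮m
    | m≤n⇒m⊓n≡m (≮⇒≥ n≮m) | m≤n⇒m⊓n≡m (m≤n⇒m≤1+n (≮⇒≥ n≮m)) = +-identityʳ m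

upTo-+ : ∀ m n → upTo (m + n) ≡ upTo m ++ applyUpTo (m +_) n
upTo-+ m zero    = trans (cong upTo (+-identityʳ m)) (sym (++-identityʳ (upTo m)))
upTo-+ m (suc n) = begin
  upTo (m + suc n)                             ≡⟨ cong upTo (+-suc m n) ⟩
  upTo (suc (m + n))                           ≡⟨ upTo-∷ʳ (m + n) ⟨
  upTo (m + n) ++ [ m + n ]                    ≡⟨ cong (_++ [ m + n ]) (upTo-+ m n) ⟩
  (upTo m ++ applyUpTo (m +_) n) ++ [ m + n ]  ≡⟨ ++-assoc (upTo m) _ _ ⟩
  upTo m ++ (applyUpTo (m +_) n ++ [ m + n ])  ≡⟨ cong (upTo m ++_) (applyUpTo-∷ʳ (m +_) n) ⟩
  upTo m ++ applyUpTo (m +_) (suc n)           ∎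
  where open ≡-Reasoning

concatMap-upTo-suc : {A : Set} (f : ℕ → List A) (n : ℕ) →
  concatMap f (upTo (suc n)) ≡ concatMap f (upTo n) ++ f n
concatMap-upTo-suc f n = begin
  concatMap f (upTo (suc n))               ≡⟨ cong (concatMap f) (upTo-∷ʳ n) ⟨
  concatMap f (upTo n ++ [ n ])            ≡⟨ concatMap-++ f (upTo n) [ n ] ⟩
  concatMap f (upTo n) ++ (f n ++ [])      ≡⟨ cong (concatMap f (upTo n) ++_) (++-identityʳ (f n)) ⟩
  concatMap f (upTo n) ++ f n              ∎
  where open ≡-Reasoning

-- Explicit indices in (ω^{↓≤2}, ≺) and in ω^{↓2}

-- After ε come the blocks k = 0, 1, …, each ordered (0,k) ≺ ⋯ ≺ (k−1,k) ≺ (k) ≺ (k,k);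
-- block k starts at blockStart k, and (j,k) sits at offset pairSlot j k inside it.
blockStart : ℕ → ℕ
blockStart zero    = 1
blockStart (suc k) = blockStart k + suc (suc k)

pairSlot : ℕ → ℕ → ℕ
pairSlot j k = if j <ᵇ k then j else suc k

rank : NSeq → ℕ
rank ε           = 0
rank (one k)     = blockStart k + k
rank (two j k _) = blockStart k + pairSlot j k

triangle : ℕ → ℕ
triangle zero    = 0
triangle (suc k) = triangle k + suc k

pairRank : NSeq → ℕ
pairRank (two j k _) = triangle k + j
pairRank _           = 0

data NonEmpty : NSeq → Set where
  one-nonempty : ∀ k → NonEmpty (one k)
  two-nonempty : ∀ j k .(p : j ≤ k) → NonEmpty (two j k p)

two-cong : ∀ {j j' k k'} .{p : j ≤ k} .{p' : j' ≤ k'} → j ≡ j' → k ≡ k' → two j k p ≡ two j' k' p'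
two-cong refl refl = refl

pairSlot-< : ∀ {j k} → j < k → pairSlot j k ≡ j
pairSlot-< j<k rewrite <ᵇ-true j<k = refl

pairSlot-diag : ∀ k → pairSlot k k ≡ suc k
pairSlot-diag k rewrite <ᵇ-false (n≮n k) = refl

pairSlot-≤ : ∀ j k → pairSlot j k ≤ suc k
pairSlot-≤ j k with j <? k
... | yes j<k rewrite <ᵇ-true j<k  = m≤n⇒m≤1+n (<⇒≤ j<k)
... | no  j≮k rewrite <ᵇ-false j≮k = ≤-refl

pairSlot-<ᵇ : ∀ {j j' k} → j ≤ k → j' ≤ k → (pairSlot j k <ᵇ pairSlot j' k) ≡ (j <ᵇ j')
pairSlot-<ᵇ {j} {j'} j≤k j'≤k with m≤n⇒m<n∨m≡n j≤k | m≤n⇒m<n∨m≡n j'≤k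
... | inj₁ j<k | inj₁ j'<k rewrite pairSlot-< j<k | pairSlot-< j'<k = refl
... | inj₁ j<k | inj₂ refl rewrite pairSlot-< j<k | pairSlot-diag j'
  = trans (<ᵇ-true (m<n⇒m<1+n j<k)) (sym (<ᵇ-true j<k))
... | inj₂ refl | inj₁ j'<k rewrite pairSlot-< j'<k | pairSlot-diag j
  = trans (<ᵇ-false (<⇒≯ (m<n⇒m<1+n j'<k))) (sym (<ᵇ-false (<⇒≯ j'<k)))
... | inj₂ refl | inj₂ refl rewrite pairSlot-diag j = refl

pairSlot-<-pairSlot : ∀ {j j' k} → j ≤ k → j' ≤ k → pairSlot j k < pairSlot j' k → j < j'
pairSlot-<-pairSlot {j} {j'} j≤k j'≤k lt = <ᵇ⇒< j j' (subst T (pairSlot-<ᵇ j≤k j'≤k) (<⇒<ᵇ lt))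

pairSlot-injective : ∀ {j j' k} → j ≤ k → j' ≤ k → pairSlot j k ≡ pairSlot j' k → j ≡ j'
pairSlot-injective {j} {j'} j≤k j'≤k eq with m≤n⇒m<n∨m≡n j≤k | m≤n⇒m<n∨m≡n j'≤k
... | inj₁ j<k | inj₁ j'<k  = trans (sym (pairSlot-< j<k)) (trans eq (pairSlot-< j'<k))
... | inj₁ j<k | inj₂ refl  =
  contradiction (trans (sym (pairSlot-< j<k)) (trans eq (pairSlot-diag j'))) (<⇒≢ (m<n⇒m<1+n j<k))
... | inj₂ refl | inj₁ j'<k =
  contradiction (trans (sym (pairSlot-< j'<k)) (trans (sym eq) (pairSlot-diag j))) (<⇒≢ (m<n⇒m<1+n j'<k))
... | inj₂ refl | inj₂ refl  = refl

pairSlot≢snd : ∀ {j k} → j ≤ k → pairSlot j k ≢ k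
pairSlot≢snd {j} j≤k with m≤n⇒m<n∨m≡n j≤k
... | inj₁ j<k  rewrite pairSlot-< j<k  = <⇒≢ j<k
... | inj₂ refl rewrite pairSlot-diag j = 1+n≢n

blockStart-suc-≤ : ∀ {m n} → m < n → blockStart (suc m) ≤ blockStart n
blockStart-suc-≤ {m} {suc n} (s≤s m≤n) with m≤n⇒m<n∨m≡n m≤n
... | inj₁ m<n  = ≤-trans (blockStart-suc-≤ m<n) (m≤m+n (blockStart n) _)
... | inj₂ refl = ≤-refl

blockStart-> : ∀ k → k < blockStart k
blockStart-> zero    = z<s
blockStart-> (suc k) = ≤-trans (s≤s (m≤n+m (suc k) (blockStart k))) (≤-reflexive (sym (+-suc (blockStart k) (suc k))))

rank-<-blockStart : ∀ s → rank s < blockStart (suc (lastE s))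
rank-<-blockStart ε           = s≤s z≤n
rank-<-blockStart (one k)     = +-monoʳ-< (blockStart k) (m<n⇒m<1+n (n<1+n k))
rank-<-blockStart (two j k _) = +-monoʳ-< (blockStart k) (s≤s (pairSlot-≤ j k))

blockStart-≤-rank : ∀ {s} → NonEmpty s → blockStart (lastE s) ≤ rank s
blockStart-≤-rank (one-nonempty k)     = m≤m+n (blockStart k) k
blockStart-≤-rank (two-nonempty j k _) = m≤m+n (blockStart k) (pairSlot j k)

rank-positive : ∀ {s} → NonEmpty s → 0 < rank s
rank-positive {s} ne = ≤-trans (≤-trans (s≤s z≤n) (blockStart-> (lastE s))) (blockStart-≤-rank ne)

nonempty-of-rank : ∀ {s} → 0 < rank s → NonEmpty s
nonempty-of-rank {ε}         ()
nonempty-of-rank {one k}     _ = one-nonempty k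
nonempty-of-rank {two j k p} _ = two-nonempty j k p

rank-<-by-lastE : ∀ t {s} → NonEmpty s → lastE t < lastE s → rank t < rank s
rank-<-by-lastE t ne lt = <-≤-trans (rank-<-blockStart t) (≤-trans (blockStart-suc-≤ lt) (blockStart-≤-rank ne))

lastE-monotone : ∀ {s t} → rank s ≤ rank t → lastE s ≤ lastE t
lastE-monotone {ε}         _  = z≤n
lastE-monotone {one k}     {t} le = ≮⇒≥ λ lt → <⇒≱ (rank-<-by-lastE t (one-nonempty k) lt) le
lastE-monotone {two j k p} {t} le = ≮⇒≥ λ lt → <⇒≱ (rank-<-by-lastE t (two-nonempty j k p) lt) le

rank-one<two : ∀ j k .(p : j ≤ k) → rank (one j) < rank (two j k p)
rank-one<two j k p with m≤n⇒m<n∨m≡n (recompute≤ p)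
... | inj₁ j<k  = rank-<-by-lastE (one j) (two-nonempty j k p) j<k
... | inj₂ refl rewrite pairSlot-diag j = +-monoʳ-< (blockStart j) (n<1+n j)

rank-two-diag : ∀ k → rank (two k k ≤-refl) ≡ suc (rank (one k))
rank-two-diag k = trans (cong (blockStart k +_) (pairSlot-diag k)) (+-suc (blockStart k) k)

lexLt-rank : ∀ {t s} → NonEmpty t → NonEmpty s → lastE t ≡ lastE s →
  lexLt (toList t) (toList s) ≡ (rank t <ᵇ rank s)
lexLt-rank (one-nonempty k) (one-nonempty _) refl
  rewrite +-<ᵇ-cancelˡ (blockStart k) k k | <ᵇ-false (n≮n k) | ≡ᵇ-true {k} refl = refl
lexLt-rank (one-nonempty k) (two-nonempty j _ p) refl
  rewrite +-<ᵇ-cancelˡ (blockStart k) k (pairSlot j k) with m≤n⇒m<n∨m≡n (recompute≤ p)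
... | inj₁ j<k  rewrite pairSlot-< j<k | <ᵇ-false (<⇒≯ j<k) | ≡ᵇ-false (>⇒≢ j<k) = refl
... | inj₂ refl rewrite pairSlot-diag k | <ᵇ-false (n≮n k) | ≡ᵇ-true {k} refl | <ᵇ-true (n<1+n k) = refl
lexLt-rank (two-nonempty j k p) (one-nonempty _) refl
  rewrite +-<ᵇ-cancelˡ (blockStart k) (pairSlot j k) k with m≤n⇒m<n∨m≡n (recompute≤ p)
... | inj₁ j<k  rewrite pairSlot-< j<k | <ᵇ-true j<k = refl
... | inj₂ refl rewrite pairSlot-diag k | <ᵇ-false (n≮n k) | ≡ᵇ-true {k} refl | <ᵇ-false (<⇒≯ (n<1+n k)) = refl
lexLt-rank (two-nonempty j k p) (two-nonempty j' _ p') refl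
  rewrite +-<ᵇ-cancelˡ (blockStart k) (pairSlot j k) (pairSlot j' k)
        | pairSlot-<ᵇ (recompute≤ p) (recompute≤ p') | <ᵇ-false (n≮n k) | ≡ᵇ-true {k} refl
        | ∧-zeroʳ (j ≡ᵇ j') = ∨-identityʳ (j <ᵇ j')

≺ᵇ-rank-nonempty : ∀ {t s} → NonEmpty t → NonEmpty s →
  ((lastE t <ᵇ lastE s) ∨ ((lastE t ≡ᵇ lastE s) ∧ lexLt (toList t) (toList s))) ≡ (rank t <ᵇ rank s)
≺ᵇ-rank-nonempty {t} {s} net nes with <-cmp (lastE t) (lastE s)
... | tri< lt _ _ rewrite <ᵇ-true lt | <ᵇ-true (rank-<-by-lastE t nes lt) = refl
... | tri≈ _ eq _ rewrite <ᵇ-false (λ lt → <⇒≢ lt eq) | ≡ᵇ-true eq = lexLt-rank net nes eq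
... | tri> _ _ gt rewrite <ᵇ-false (<⇒≯ gt) | ≡ᵇ-false (>⇒≢ gt) | <ᵇ-false (<⇒≯ (rank-<-by-lastE s net gt)) = refl

≺ᵇ-rank : ∀ t s → (t ≺ᵇ s) ≡ (rank t <ᵇ rank s)
≺ᵇ-rank ε           ε             = refl
≺ᵇ-rank ε           (one k)       = sym (<ᵇ-true (rank-positive (one-nonempty k)))
≺ᵇ-rank ε           (two j k p)   = sym (<ᵇ-true (rank-positive (two-nonempty j k p)))
≺ᵇ-rank (one _)     ε             = refl
≺ᵇ-rank (two _ _ _) ε             = refl
≺ᵇ-rank (one k)     (one k')      = ≺ᵇ-rank-nonempty (one-nonempty k) (one-nonempty k')
≺ᵇ-rank (one k)     (two j' k' p) = ≺ᵇ-rank-nonempty (one-nonempty k) (two-nonempty j' k' p)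
≺ᵇ-rank (two j k p) (one k')      = ≺ᵇ-rank-nonempty (two-nonempty j k p) (one-nonempty k')
≺ᵇ-rank (two j k p) (two j' k' q) = ≺ᵇ-rank-nonempty (two-nonempty j k p) (two-nonempty j' k' q)

pairsUpTo : ℕ → ℕ → List NSeq
pairsUpTo k n = concatMap (λ j → mkTwo j k) (upTo n)

block : ℕ → List NSeq
block k = one k ∷ pairsUpTo k (suc k)

mkTwo-≤ : ∀ {j k} .(p : j ≤ k) → mkTwo j k ≡ [ two j k p ]
mkTwo-≤ {j} {k} p with j ≤? k
... | yes _   = refl
... | no  j≰k = ⊥-elim-irr (j≰k p)

pairsUpTo-suc : ∀ {k n} (n≤k : n ≤ k) → pairsUpTo k (suc n) ≡ pairsUpTo k n ++ [ two n k n≤k ]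
pairsUpTo-suc {k} {n} n≤k = trans (concatMap-upTo-suc (λ j → mkTwo j k) n) (cong (pairsUpTo k n ++_) (mkTwo-≤ n≤k))

map-pairsUpTo : ∀ {B : Set} (f : NSeq → B) (g : ℕ → B) {k} n → n ≤ suc k →
  (∀ j .(p : j ≤ k) → j < n → f (two j k p) ≡ g j) → map f (pairsUpTo k n) ≡ applyUpTo g n
map-pairsUpTo f g         zero    _   _      = refl
map-pairsUpTo f g {k} (suc n) n<k f≗g = begin
  map f (pairsUpTo k (suc n))                     ≡⟨ cong (map f) (pairsUpTo-suc n≤k) ⟩
  map f (pairsUpTo k n ++ [ two n k n≤k ])        ≡⟨ map-++ f (pairsUpTo k n) _ ⟩
  map f (pairsUpTo k n) ++ [ f (two n k n≤k) ]    ≡⟨ cong₂ (λ xs y → xs ++ [ y ]) earlier (f≗g n n≤k ≤-refl) ⟩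
  applyUpTo g n ++ [ g n ]                        ≡⟨ applyUpTo-∷ʳ g n ⟩
  applyUpTo g (suc n)                             ∎
  where
  open ≡-Reasoning
  n≤k = s≤s⁻¹ n<k
  earlier = map-pairsUpTo f g n (m≤n⇒m≤1+n n≤k) λ j p j<n → f≗g j p (m<n⇒m<1+n j<n)

rank-block : ∀ k → map rank (block k) ↭ applyUpTo (blockStart k +_) (suc (suc k))
rank-block k = begin
  b + k ∷ map rank (pairsUpTo k (suc k))                ≡⟨ cong (λ ps → b + k ∷ map rank ps) (pairsUpTo-suc ≤-refl) ⟩
  b + k ∷ map rank (pairsUpTo k k ++ [ two k k _ ])     ≡⟨ cong (b + k ∷_) (map-++ rank (pairsUpTo k k) _) ⟩
  b + k ∷ map rank (pairsUpTo k k) ++ [ b + pairSlot k k ]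
    ≡⟨ cong₂ (λ xs y → b + k ∷ xs ++ [ b + y ])
             (map-pairsUpTo rank (b +_) k (n≤1+n k) λ j p j<k → cong (b +_) (pairSlot-< j<k)) (pairSlot-diag k) ⟩
  b + k ∷ applyUpTo (b +_) k ++ [ b + suc k ]           ↭⟨ shift (b + k) (applyUpTo (b +_) k) [ b + suc k ] ⟨
  applyUpTo (b +_) k ++ [ b + k ] ++ [ b + suc k ]      ≡⟨ ++-assoc (applyUpTo (b +_) k) [ b + k ] [ b + suc k ] ⟨
  (applyUpTo (b +_) k ++ [ b + k ]) ++ [ b + suc k ]    ≡⟨ cong (_++ [ b + suc k ]) (applyUpTo-∷ʳ (b +_) k) ⟩
  applyUpTo (b +_) (suc k) ++ [ b + suc k ]             ≡⟨ applyUpTo-∷ʳ (b +_) (suc k) ⟩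
  applyUpTo (b +_) (suc (suc k))                        ∎
  where
  open PermutationReasoning
  b = blockStart k

rank-blocks : ∀ K → map rank (ε ∷ concatMap block (upTo K)) ↭ upTo (blockStart K)
rank-blocks zero    = ↭-reflexive refl
rank-blocks (suc K) = begin
  map rank (ε ∷ concatMap block (upTo (suc K)))
    ≡⟨ cong (λ xs → map rank (ε ∷ xs)) (concatMap-upTo-suc block K) ⟩
  map rank (ε ∷ concatMap block (upTo K) ++ block K)
    ≡⟨ map-++ rank (ε ∷ concatMap block (upTo K)) (block K) ⟩
  map rank (ε ∷ concatMap block (upTo K)) ++ map rank (block K)
    ↭⟨ ++⁺ (rank-blocks K) (rank-block K) ⟩
  upTo (blockStart K) ++ applyUpTo (blockStart K +_) (suc (suc K))
    ≡⟨ upTo-+ (blockStart K) (suc (suc K)) ⟨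
  upTo (blockStart (suc K)) ∎
  where open PermutationReasoning

rank-allUpTo : ∀ K → map rank (allUpTo K) ↭ upTo (blockStart (suc K))
rank-allUpTo K = rank-blocks (suc K)

idx≡rank : ∀ s → idx s ≡ rank s
idx≡rank s = begin
  count (_≺ᵇ s) (allUpTo K)                           ≡⟨ count-cong (λ t → ≺ᵇ-rank t s) (allUpTo K) ⟩
  count ((_<ᵇ rank s) ∘ rank) (allUpTo K)             ≡⟨ count-map (_<ᵇ rank s) rank (allUpTo K) ⟨
  count (_<ᵇ rank s) (map rank (allUpTo K))           ≡⟨ count-↭ (_<ᵇ rank s) (rank-allUpTo K) ⟩
  count (_<ᵇ rank s) (upTo (blockStart (suc K)))      ≡⟨ count-<ᵇ-upTo (rank s) (blockStart (suc K)) ⟩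
  rank s ⊓ blockStart (suc K)                         ≡⟨ m≤n⇒m⊓n≡m (<⇒≤ (rank-<-blockStart s)) ⟩
  rank s                                              ∎
  where
  open ≡-Reasoning
  K = lastE s

filter-isTwo-pairsUpTo : ∀ k n → n ≤ suc k → filterᵇ isTwo (pairsUpTo k n) ≡ pairsUpTo k n
filter-isTwo-pairsUpTo k zero    _   = refl
filter-isTwo-pairsUpTo k (suc n) n<k = begin
  filterᵇ isTwo (pairsUpTo k (suc n))              ≡⟨ cong (filterᵇ isTwo) (pairsUpTo-suc n≤k) ⟩
  filterᵇ isTwo (pairsUpTo k n ++ [ two n k n≤k ]) ≡⟨ filter-++ (T? ∘ isTwo) (pairsUpTo k n) _ ⟩
  filterᵇ isTwo (pairsUpTo k n) ++ [ two n k n≤k ] ≡⟨ cong (_++ [ two n k n≤k ]) (filter-isTwo-pairsUpTo k n (m≤n⇒m≤1+n n≤k)) ⟩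
  pairsUpTo k n ++ [ two n k n≤k ]                 ≡⟨ pairsUpTo-suc n≤k ⟨
  pairsUpTo k (suc n)                              ∎
  where
  open ≡-Reasoning
  n≤k = s≤s⁻¹ n<k

pairRank-block : ∀ k → map pairRank (filterᵇ isTwo (block k)) ≡ applyUpTo (triangle k +_) (suc k)
pairRank-block k = trans (cong (map pairRank) (filter-isTwo-pairsUpTo k (suc k) ≤-refl))
                         (map-pairsUpTo pairRank (triangle k +_) (suc k) ≤-refl λ _ _ _ → refl)

pairRank-blocks : ∀ K → map pairRank (filterᵇ isTwo (concatMap block (upTo K))) ≡ upTo (triangle K)
pairRank-blocks zero    = refl
pairRank-blocks (suc K) = begin
  map pairRank (filterᵇ isTwo (concatMap block (upTo (suc K))))
    ≡⟨ cong (map pairRank ∘ filterᵇ isTwo) (concatMap-upTo-suc block K) ⟩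
  map pairRank (filterᵇ isTwo (concatMap block (upTo K) ++ block K))
    ≡⟨ cong (map pairRank) (filter-++ (T? ∘ isTwo) (concatMap block (upTo K)) (block K)) ⟩
  map pairRank (filterᵇ isTwo (concatMap block (upTo K)) ++ filterᵇ isTwo (block K))
    ≡⟨ map-++ pairRank (filterᵇ isTwo (concatMap block (upTo K))) _ ⟩
  map pairRank (filterᵇ isTwo (concatMap block (upTo K))) ++ map pairRank (filterᵇ isTwo (block K))
    ≡⟨ cong₂ _++_ (pairRank-blocks K) (pairRank-block K) ⟩
  upTo (triangle K) ++ applyUpTo (triangle K +_) (suc K)
    ≡⟨ upTo-+ (triangle K) (suc K) ⟨
  upTo (triangle (suc K)) ∎
  where open ≡-Reasoning

triangle-suc-≤ : ∀ {m n} → m < n → triangle (suc m) ≤ triangle n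
triangle-suc-≤ {m} {suc n} (s≤s m≤n) with m≤n⇒m<n∨m≡n m≤n
... | inj₁ m<n  = ≤-trans (triangle-suc-≤ m<n) (m≤m+n (triangle n) _)
... | inj₂ refl = ≤-refl

pairRank-<-triangle : ∀ {j k} → j ≤ k → triangle k + j < triangle (suc k)
pairRank-<-triangle {k = k} j≤k = +-monoʳ-< (triangle k) (s≤s j≤k)

pairRank-<-by-snd : ∀ {j k j' k'} → j ≤ k → k < k' → triangle k + j < triangle k' + j'
pairRank-<-by-snd {k' = k'} j≤k k<k' =
  <-≤-trans (pairRank-<-triangle j≤k) (≤-trans (triangle-suc-≤ k<k') (m≤m+n (triangle k') _))

rank-<ᵇ-pairRank : ∀ j k .(p : j ≤ k) j' k' .(p' : j' ≤ k') →
  (rank (two j k p) <ᵇ rank (two j' k' p')) ≡ (triangle k + j <ᵇ triangle k' + j')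
rank-<ᵇ-pairRank j k p j' k' p' with <-cmp k k'
... | tri< k<k' _ _ rewrite <ᵇ-true (rank-<-by-lastE (two j k p) (two-nonempty j' k' p') k<k')
                          | <ᵇ-true (pairRank-<-by-snd {j' = j'} (recompute≤ p) k<k') = refl
... | tri> _ _ k>k' rewrite <ᵇ-false (<⇒≯ (rank-<-by-lastE (two j' k' p') (two-nonempty j k p) k>k'))
                          | <ᵇ-false (<⇒≯ (pairRank-<-by-snd {j' = j} (recompute≤ p') k>k')) = refl
... | tri≈ _ refl _ rewrite +-<ᵇ-cancelˡ (blockStart k) (pairSlot j k) (pairSlot j' k)
                          | +-<ᵇ-cancelˡ (triangle k) j j' = pairSlot-<ᵇ (recompute≤ p) (recompute≤ p')

idx2≡pairRank : ∀ j k .(p : j ≤ k) → idx2 (two j k p) ≡ triangle k + j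
idx2≡pairRank j k p = begin
  count (λ t → isTwo t ∧ (t ≺ᵇ s)) (allUpTo k)             ≡⟨ count-cong ≺ᵇ≗ (allUpTo k) ⟩
  count (λ t → isTwo t ∧ (pairRank t <ᵇ ρ)) (allUpTo k)    ≡⟨ count-∧ isTwo (λ t → pairRank t <ᵇ ρ) (allUpTo k) ⟩
  count ((_<ᵇ ρ) ∘ pairRank) (filterᵇ isTwo (allUpTo k))   ≡⟨ count-map (_<ᵇ ρ) pairRank (filterᵇ isTwo (allUpTo k)) ⟨
  count (_<ᵇ ρ) (map pairRank (filterᵇ isTwo (allUpTo k))) ≡⟨ cong (count (_<ᵇ ρ)) (pairRank-blocks (suc k)) ⟩
  count (_<ᵇ ρ) (upTo (triangle (suc k)))                  ≡⟨ count-<ᵇ-upTo ρ (triangle (suc k)) ⟩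
  ρ ⊓ triangle (suc k)                                     ≡⟨ m≤n⇒m⊓n≡m (<⇒≤ (pairRank-<-triangle (recompute≤ p))) ⟩
  ρ                                                        ∎
  where
  open ≡-Reasoning
  s = two j k p
  ρ = triangle k + j
  ≺ᵇ≗ : ∀ t → (isTwo t ∧ (t ≺ᵇ s)) ≡ (isTwo t ∧ (pairRank t <ᵇ ρ))
  ≺ᵇ≗ ε              = refl
  ≺ᵇ≗ (one _)        = refl
  ≺ᵇ≗ (two j' k' p') = trans (≺ᵇ-rank (two j' k' p') s) (rank-<ᵇ-pairRank j' k' p' j k p)

rank≡0 : ∀ {s} → rank s ≡ 0 → s ≡ ε
rank≡0 {ε}         _  = refl
rank≡0 {one k}     eq = contradiction eq (≢-sym (<⇒≢ (rank-positive (one-nonempty k))))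
rank≡0 {two j k p} eq = contradiction eq (≢-sym (<⇒≢ (rank-positive (two-nonempty j k p))))

rank-injective-nonempty : ∀ {t s} → NonEmpty t → NonEmpty s → rank t ≡ rank s → t ≡ s
rank-injective-nonempty {t} {s} net nes eq with <-cmp (lastE t) (lastE s)
... | tri< lt _ _ = contradiction eq (<⇒≢ (rank-<-by-lastE t nes lt))
... | tri> _ _ gt = contradiction (sym eq) (<⇒≢ (rank-<-by-lastE s net gt))
... | tri≈ _ same _ = within-block net nes same eq
  where
  within-block : ∀ {t s} → NonEmpty t → NonEmpty s → lastE t ≡ lastE s → rank t ≡ rank s → t ≡ s
  within-block (one-nonempty k)     (one-nonempty _)      refl _  = refl
  within-block (one-nonempty k)     (two-nonempty j _ p)  refl eq =
    contradiction (sym (+-cancelˡ-≡ (blockStart k) k _ eq)) (pairSlot≢snd (recompute≤ p))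
  within-block (two-nonempty j k p) (one-nonempty _)      refl eq =
    contradiction (+-cancelˡ-≡ (blockStart k) _ k eq) (pairSlot≢snd (recompute≤ p))
  within-block (two-nonempty j k p) (two-nonempty j' _ p') refl eq
    with refl ← pairSlot-injective (recompute≤ p) (recompute≤ p') (+-cancelˡ-≡ (blockStart k) _ _ eq) = refl

rank-injective : ∀ {t s} → rank t ≡ rank s → t ≡ s
rank-injective {ε}         eq = sym (rank≡0 (sym eq))
rank-injective {one k}     {ε} eq = rank≡0 eq
rank-injective {two j k p} {ε} eq = rank≡0 eq
rank-injective {one k}     {one k'}      = rank-injective-nonempty (one-nonempty k) (one-nonempty k')
rank-injective {one k}     {two j' k' p'} = rank-injective-nonempty (one-nonempty k) (two-nonempty j' k' p')
rank-injective {two j k p} {one k'}      = rank-injective-nonempty (two-nonempty j k p) (one-nonempty k')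
rank-injective {two j k p} {two j' k' p'} = rank-injective-nonempty (two-nonempty j k p) (two-nonempty j' k' p')

rank-surjective : ∀ m → ∃[ s ] s ∈ allUpTo m × rank s ≡ m
rank-surjective m = let s , s∈ , m≡rank = ∈-map⁻ rank m∈ranks in s , s∈ , sym m≡rank
  where
  m<blockStart : m < blockStart (suc m)
  m<blockStart = <-≤-trans (blockStart-> m) (m≤m+n (blockStart m) (suc (suc m)))
  m∈ranks : m ∈ map rank (allUpTo m)
  m∈ranks = ∈-resp-↭ (↭-sym (rank-allUpTo m)) (∈-upTo⁺ m<blockStart)

rank-jvec : ∀ m → rank (jvec m) ≡ m
rank-jvec m = from-witness (rank-surjective m)
  where
  from-witness : ∃[ s ] s ∈ allUpTo m × rank s ≡ m → rank (jvec m) ≡ m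
  from-witness (s , s∈ , rank≡m)
    with findᵇ (λ t → idx t ≡ᵇ m) (allUpTo m)
       | findᵇ-just (λ t → idx t ≡ᵇ m) s∈ (≡⇒≡ᵇ (idx s) m (trans (idx≡rank s) rank≡m))
  ... | .(just t) | t , refl , idx≡m = trans (sym (idx≡rank t)) (≡ᵇ⇒≡ (idx t) m idx≡m)

jvec-rank : ∀ s → jvec (rank s) ≡ s
jvec-rank s = rank-injective (rank-jvec (rank s))

jvec-nonempty : ∀ {m} → 0 < m → NonEmpty (jvec m)
jvec-nonempty {m} 0<m = nonempty-of-rank (subst (0 <_) (sym (rank-jvec m)) 0<m)

data IvecView (n : ℕ) : Set where
  ivec≡two : ∀ j k (j≤k : j ≤ k) → ivec n ≡ two j k j≤k → triangle k + j ≡ n → IvecView n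

pairRank-surjective : ∀ n → ∃[ s ] s ∈ allUpTo n × T (isTwo s) × pairRank s ≡ n
pairRank-surjective n =
  let s , s∈ , n≡rank    = ∈-map⁻ pairRank n∈ranks
      s∈allUpTo , isTwo-s = ∈-filter⁻ (T? ∘ isTwo) {xs = allUpTo n} s∈
  in s , s∈allUpTo , isTwo-s , sym n≡rank
  where
  n∈ranks : n ∈ map pairRank (filterᵇ isTwo (allUpTo n))
  n∈ranks = subst (n ∈_) (sym (pairRank-blocks (suc n))) (∈-upTo⁺ (m≤n+m (suc n) (triangle n)))

ivec-view : ∀ n → IvecView n
ivec-view n = view (found (pairRank-surjective n))
  where
  P : NSeq → Bool
  P t = isTwo t ∧ (idx2 t ≡ᵇ n)
  hit : ∀ t → T (isTwo t) → pairRank t ≡ n → T (P t)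
  hit (two j k p) _ eq = ≡⇒≡ᵇ (idx2 (two j k p)) n (trans (idx2≡pairRank j k p) eq)
  found : ∃[ s ] s ∈ allUpTo n × T (isTwo s) × pairRank s ≡ n → ∃[ t ] ivec n ≡ t × T (P t)
  found (s , s∈ , isTwo-s , rank≡n) with findᵇ P (allUpTo n) | findᵇ-just P s∈ (hit s isTwo-s rank≡n)
  ... | .(just t) | t , refl , Pt = t , refl , Pt
  view : ∃[ t ] ivec n ≡ t × T (P t) → IvecView n
  view (two j k p , ivec≡ , Pt) = ivec≡two j k (recompute≤ p) ivec≡ (trans (sym (idx2≡pairRank j k p)) (≡ᵇ⇒≡ _ n Pt))

pairRank-injective : ∀ {j k j' k'} → j ≤ k → j' ≤ k' → triangle k + j ≡ triangle k' + j' → j ≡ j' × k ≡ k'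
pairRank-injective {j} {k} {j'} {k'} j≤k j'≤k' eq with <-cmp k k'
... | tri< k<k' _ _ = contradiction eq (<⇒≢ (pairRank-<-by-snd {j' = j'} j≤k k<k'))
... | tri> _ _ k>k' = contradiction (sym eq) (<⇒≢ (pairRank-<-by-snd {j' = j} j'≤k' k>k'))
... | tri≈ _ refl _ = +-cancelˡ-≡ (triangle k) j j' eq , refl

ivec-pairRank : ∀ j k .(p : j ≤ k) → ivec (triangle k + j) ≡ two j k p
ivec-pairRank j k p with ivec-view (triangle k + j)
... | ivec≡two j' k' p' eq rank≡
  with refl , refl ← pairRank-injective p' (recompute≤ p) rank≡ = eq

ivec-nonempty : ∀ n → NonEmpty (ivec n)
ivec-nonempty n with ivec-view n
... | ivec≡two j k p eq _ = subst NonEmpty (sym eq) (two-nonempty j k p)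

rank-ivec-< : ∀ {p q} → p < q → rank (ivec p) < rank (ivec q)
rank-ivec-< {p} {q} p<q with ivec-view p | ivec-view q
... | ivec≡two j k x e _≡p | ivec≡two j' k' x' e' _≡q rewrite e | e' =
  <ᵇ⇒< _ _ (subst T (sym (rank-<ᵇ-pairRank j k x j' k' x')) (<⇒<ᵇ (subst₂ _<_ (sym _≡p) (sym _≡q) p<q)))

rank-ivec≢rank-one : ∀ q k → rank (ivec q) ≢ rank (one k)
rank-ivec≢rank-one q k eq with ivec-view q
... | ivec≡two j k' p ivec≡ _ with () ← trans (sym ivec≡) (rank-injective {ivec q} {one k} eq)

rank-ivec-<-rank-one : ∀ {q k} → q < triangle k + k → rank (ivec q) < rank (one k)
rank-ivec-<-rank-one {q} {k} q<n = ≤∧≢⇒< (s≤s⁻¹ (begin-strict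
  rank (ivec q)                  <⟨ rank-ivec-< q<n ⟩
  rank (ivec (triangle k + k))   ≡⟨ cong rank (ivec-pairRank k k ≤-refl) ⟩
  rank (two k k ≤-refl)          ≡⟨ rank-two-diag k ⟩
  suc (rank (one k))             ∎)) (rank-ivec≢rank-one q k)
  where open ≤-Reasoning

-- Infinite pigeonhole and Ramsey's theorem for pairs

StrictlyIncreasing : (ℕ → ℕ) → Set
StrictlyIncreasing f = ∀ i → f i < f (suc i)

increasing-from : ∀ (f : ℕ → ℕ) {a} → (∀ i → a ≤ i → f i < f (suc i)) →
  ∀ {i j} → a ≤ i → i < j → f i < f j
increasing-from f step a≤i (s≤s i≤j) with m≤n⇒m<n∨m≡n i≤j
... | inj₁ i<j  = <-trans (increasing-from f step a≤i i<j) (step _ (≤-trans a≤i (<⇒≤ i<j)))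
... | inj₂ refl = step _ a≤i

increasing-< : ∀ {f} → StrictlyIncreasing f → ∀ {i j} → i < j → f i < f j
increasing-< {f} f↑ = increasing-from f (λ i _ → f↑ i) z≤n

increasing-≤ : ∀ {f} → StrictlyIncreasing f → ∀ {i j} → i ≤ j → f i ≤ f j
increasing-≤ f↑ i≤j with m≤n⇒m<n∨m≡n i≤j
... | inj₁ i<j  = <⇒≤ (increasing-< f↑ i<j)
... | inj₂ refl = ≤-refl

record IncreasingAbove (L : ℕ) : Set where
  field
    seq        : ℕ → ℕ
    increasing : StrictlyIncreasing seq
    above      : L < seq 0

  seq-above : ∀ i → L < seq i
  seq-above i = <-≤-trans above (increasing-≤ increasing z≤n)

open IncreasingAbove public

Infinite : (ℕ → Set) → Set
Infinite S = ∀ N → ∃[ v ] N < v × S v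

enumerate : ∀ {S} → Infinite S → (L : ℕ) → Σ (IncreasingAbove L) λ F → ∀ i → S (seq F i)
enumerate {S} S-inf L =
  record { seq = f ; increasing = λ i → proj₁ (proj₂ (S-inf (f i))) ; above = proj₁ (proj₂ (S-inf L)) } , f∈S
  where
  f : ℕ → ℕ
  f zero    = proj₁ (S-inf L)
  f (suc i) = proj₁ (S-inf (f i))
  f∈S : ∀ i → S (f i)
  f∈S zero    = proj₂ (proj₂ (S-inf L))
  f∈S (suc i) = proj₂ (proj₂ (S-inf (f i)))

module _ (em : ExcludedMiddle 0ℓ) where

  pigeonhole : ∀ {S} → Infinite S → (c : ℕ → Bool) → ∃[ b ] Infinite (λ v → S v × c v ≡ b)
  pigeonhole {S} S-inf c with em {Infinite (λ v → S v × c v ≡ true)}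
  ... | yes true-inf = true , true-inf
  ... | no  true-fin = false , λ N → decidable-stable em λ no-false-above-N →
    true-fin λ N' →
      let v , N⊔N'<v , Sv = S-inf (N ⊔ N') in
      v , ≤-<-trans (m≤n⊔m N N') N⊔N'<v , Sv ,
      ¬-not (λ cv≡false → no-false-above-N (v , ≤-<-trans (m≤m⊔n N N') N⊔N'<v , Sv , cv≡false))

  homogeneous-sequence : (c : ℕ → Bool) (L : ℕ) →
    Σ (IncreasingAbove L) λ F → ∃[ b ] ∀ i → c (seq F i) ≡ b
  homogeneous-sequence c L =
    let b , inf = pigeonhole {λ _ → ⊤} (λ N → suc N , ≤-refl , _) c
        F , F∈ = enumerate inf L
    in F , b , λ i → proj₂ (F∈ i)

  -- Each stage fixes a pivot and an infinite pool of larger candidates on which the colour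
  -- of pairs with that pivot is constant; along the pivots c (pᵢ, pⱼ) then depends only on
  -- i < j, and one more pigeonhole finishes.
  record Stage : Set₁ where
    field
      pivot         : ℕ
      pool          : ℕ → Set
      pool-infinite : Infinite pool
      pool-above    : ∀ {v} → pool v → pivot < v

  module RamseyConstruction (c : ℕ → ℕ → Bool) (L : ℕ) where
    open Stage

    colour : Stage → Bool
    colour st = proj₁ (pigeonhole (pool-infinite st) (c (pivot st)))

    next : Stage → Stage
    next st = record
      { pivot         = h
      ; pool          = λ v → (pool st v × c (pivot st) v ≡ colour st) × h < v
      ; pool-infinite = λ N → let v , N⊔h<v , mv = matching (N ⊔ h)
                              in v , ≤-<-trans (m≤m⊔n N h) N⊔h<v , mv , ≤-<-trans (m≤n⊔m N h) N⊔h<v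
      ; pool-above    = proj₂
      }
      where
      matching = proj₂ (pigeonhole (pool-infinite st) (c (pivot st)))
      h = proj₁ (matching (pivot st))

    next-pivot : ∀ st → pool st (pivot (next st)) × c (pivot st) (pivot (next st)) ≡ colour st
    next-pivot st = proj₂ (proj₂ (proj₂ (pigeonhole (pool-infinite st) (c (pivot st))) (pivot st)))

    stage : ℕ → Stage
    stage zero    = record
      { pivot         = suc L
      ; pool          = suc L <_
      ; pool-infinite = λ N → suc (N ⊔ suc L) , s≤s (m≤m⊔n N (suc L)) , s≤s (m≤n⊔m N (suc L))
      ; pool-above    = λ v>L → v>L
      }
    stage (suc i) = next (stage i)

    pivots : ℕ → ℕ
    pivots i = pivot (stage i)

    pivots-increasing : StrictlyIncreasing pivots
    pivots-increasing i = pool-above (stage i) (proj₁ (next-pivot (stage i)))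

    pool-antitone : ∀ {i j v} → i ≤ j → pool (stage j) v → pool (stage i) v
    pool-antitone {j = zero}  z≤n  r = r
    pool-antitone {j = suc j} i≤sj r with m≤n⇒m<n∨m≡n i≤sj
    ... | inj₁ i<sj = pool-antitone (s≤s⁻¹ i<sj) (proj₁ (proj₁ r))
    ... | inj₂ refl = r

    colour-later : ∀ {i j} → i < j → c (pivots i) (pivots j) ≡ colour (stage i)
    colour-later {i} {suc j} (s≤s i≤j) with m≤n⇒m<n∨m≡n i≤j
    ... | inj₁ i<j  = proj₂ (proj₁ (pool-antitone i<j (proj₁ (next-pivot (stage j)))))
    ... | inj₂ refl = proj₂ (next-pivot (stage i))

  ramsey : (c : ℕ → ℕ → Bool) (L : ℕ) →
    Σ (IncreasingAbove L) λ F → ∃[ b ] ∀ {p q} → p < q → c (seq F p) (seq F q) ≡ b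
  ramsey c L =
    record { seq = pivots ∘ seq G
           ; increasing = λ i → increasing-< pivots-increasing (increasing G i)
           ; above = <-≤-trans (n<1+n L) (increasing-≤ pivots-increasing {0} {seq G 0} z≤n) } ,
    b , λ {p} p<q → trans (colour-later (increasing-< (increasing G) p<q)) (G-homogeneous p)
    where
    open RamseyConstruction c L
    homogeneous-colours = homogeneous-sequence (colour ∘ stage) 0
    G = proj₁ homogeneous-colours
    b = proj₁ (proj₂ homogeneous-colours)
    G-homogeneous = proj₂ (proj₂ homogeneous-colours)

-- Basic properties of ℰ₂-trees

head : List ℕ → ℕ
head []      = 0
head (x ∷ _) = x

top : E2Tree → NSeq → ℕ
top X s = maxL (fun X s)

ProperInitSeg-singleton : ∀ {x y z} → y < z → ProperInitSeg [ x ] (y ∷ [ z ]) → x ≡ y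
ProperInitSeg-singleton {x} y<z (sub , _ , below) with sub x (here refl)
... | here x≡y = x≡y
... | there (here x≡z) =
  contradiction (below x _ (here refl) (here refl) λ { (here y≡x) → <⇒≢ y<z (trans y≡x x≡z) })
                (<⇒≯ (subst (_ <_) (sym x≡z) y<z))

length-W2 : ∀ l → length (W2 l) ≡ len l
length-W2 ε           = refl
length-W2 (one _)     = refl
length-W2 (two _ _ _) = refl

module _ (X : E2Tree) where

  private
    label : NSeq → NSeq
    label s = proj₁ (inW X s)

    fun≡W2 : ∀ s → fun X s ≡ W2 (label s)
    fun≡W2 s = proj₂ (inW X s)

    len-label : ∀ s → len (label s) ≡ len s
    len-label s = trans (sym (length-W2 (label s))) (trans (cong length (sym (fun≡W2 s))) (lenOK X s))

  fun-one : ∀ j → ∃[ a ] fun X (one j) ≡ [ rank (one a) ]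
  fun-one j with label (one j) | fun≡W2 (one j) | len-label (one j)
  ... | one a | eq | _ = a , trans eq (cong [_] (idx≡rank (one a)))

  fun-two : ∀ j k .(p : j ≤ k) →
    ∃[ a ] ∃[ b ] Σ (a ≤ b) λ q → fun X (two j k p) ≡ rank (one a) ∷ [ rank (two a b q) ]
  fun-two j k p with label (two j k p) | fun≡W2 (two j k p) | len-label (two j k p)
  ... | two a b q | eq | _ =
    a , b , recompute≤ q , trans eq (cong₂ (λ x y → x ∷ [ y ]) (idx≡rank (one a)) (idx≡rank (two a b q)))

  top-increasing : ∀ {s t} → NonEmpty s → rank s < rank t → top X s < top X t
  top-increasing {s} {t} ne s<t = subst₂ (λ s t → top X s < top X t) (jvec-rank s) (jvec-rank t)
    (increasing-from (top X ∘ jvec) (incr X) (rank-positive ne) s<t)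

  top-monotone : ∀ {s t} → NonEmpty s → rank s ≤ rank t → top X s ≤ top X t
  top-monotone ne s≤t with m≤n⇒m<n∨m≡n s≤t
  ... | inj₁ s<t = <⇒≤ (top-increasing ne s<t)
  ... | inj₂ eq  = ≤-reflexive (cong (top X) (rank-injective eq))

  top-one-< : ∀ {u v} → u < v → top X (one u) < top X (one v)
  top-one-< {u} {v} u<v = top-increasing (one-nonempty u) (rank-<-by-lastE (one u) (one-nonempty v) u<v)

  top-one-injective : ∀ {u v} → top X (one u) ≡ top X (one v) → u ≡ v
  top-one-injective {u} {v} eq with <-cmp u v
  ... | tri< u<v _ _ = contradiction eq (<⇒≢ (top-one-< u<v))
  ... | tri≈ _ u≡v _ = u≡v
  ... | tri> _ _ u>v = contradiction (sym eq) (<⇒≢ (top-one-< u>v))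

  head-pair : ∀ j k .(p : j ≤ k) → head (fun X (two j k p)) ≡ top X (one j)
  head-pair j k p with fun-one j | fun-two j k p | segFr X (one j) (two j k p) (k , [] , refl)
  ... | a , eq₁ | a' , b , q , eq₂ | seg rewrite eq₁ | eq₂ =
    sym (trans (⊔-identityʳ _) (ProperInitSeg-singleton (rank-one<two a' b q) seg))

-- Thinning a tree while keeping an initial segment

-- A new pair (j,k) with j < k, a new node (k) and a new pair (k,k) are sent to sequences
-- ending in F (3k), F (3k+1) and F (3k+2) respectively, which keeps ≺ and prefixes intact.
column : NSeq → ℕ
column ε           = 0
column (one k)     = suc (3 * k)
column (two j k _) = if j <ᵇ k then 3 * k else suc (suc (3 * k))

column-two-< : ∀ {j k} .{p : j ≤ k} → j < k → column (two j k p) ≡ 3 * k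
column-two-< j<k rewrite <ᵇ-true j<k = refl

column-two-diag : ∀ k .{p : k ≤ k} → column (two k k p) ≡ suc (suc (3 * k))
column-two-diag k rewrite <ᵇ-false (n≮n k) = refl

column-≤ : ∀ s → column s ≤ suc (suc (3 * lastE s))
column-≤ ε           = z≤n
column-≤ (one k)     = n≤1+n _
column-≤ (two j k p) with j <? k
... | yes j<k rewrite column-two-< {p = p} j<k = m≤n+m (3 * k) 2
... | no  j≮k rewrite <ᵇ-false j≮k = ≤-refl

3*lastE-≤-column : ∀ {s} → NonEmpty s → 3 * lastE s ≤ column s
3*lastE-≤-column (one-nonempty k)     = n≤1+n _
3*lastE-≤-column (two-nonempty j k p) with j <? k
... | yes j<k rewrite column-two-< {p = p} j<k = ≤-refl
... | no  j≮k rewrite <ᵇ-false j≮k = m≤n+m (3 * k) 2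

m<n⇒2+3m<3n : ∀ {k k'} → k < k' → suc (suc (3 * k)) < 3 * k'
m<n⇒2+3m<3n {k} k<k' = ≤-trans (≤-reflexive (sym (*-suc 3 k))) (*-monoʳ-≤ 3 k<k')

column-one<two : ∀ {j k} .(p : j ≤ k) → column (one j) < column (two j k p)
column-one<two {j} {k} p with m≤n⇒m<n∨m≡n (recompute≤ p)
... | inj₁ j<k  rewrite column-two-< {p = p} j<k = <⇒≤ (m<n⇒2+3m<3n j<k)
... | inj₂ refl rewrite column-two-diag j {p} = n<1+n _

data ColumnOrder : NSeq → NSeq → Set where
  column-<    : ∀ {s t} → column s < column t → ColumnOrder s t
  same-column : ∀ {j j' k} .(p : j ≤ k) .(p' : j' ≤ k) → j < j' → j' < k → ColumnOrder (two j k p) (two j' k p')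

column-order-in-block : ∀ {s t} → NonEmpty s → NonEmpty t → lastE s ≡ lastE t → rank s < rank t → ColumnOrder s t
column-order-in-block (one-nonempty k) (one-nonempty _) refl s<t = contradiction s<t (n≮n _)
column-order-in-block (one-nonempty k) (two-nonempty j' _ p') refl s<t
  with m≤n⇒m<n∨m≡n (recompute≤ p')
... | inj₁ j'<k rewrite pairSlot-< j'<k = contradiction (+-cancelˡ-< (blockStart k) k j' s<t) (<⇒≯ j'<k)
... | inj₂ refl = column-< (column-one<two p')
column-order-in-block (two-nonempty j k p) (one-nonempty _) refl s<t
  with m≤n⇒m<n∨m≡n (recompute≤ p)
... | inj₁ j<k  = column-< (subst (_< suc (3 * k)) (sym (column-two-< {p = p} j<k)) (n<1+n _))
... | inj₂ refl rewrite pairSlot-diag k = contradiction (+-cancelˡ-< (blockStart k) (suc k) k s<t) (<⇒≯ (n<1+n k))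
column-order-in-block (two-nonempty j k p) (two-nonempty j' _ p') refl s<t
  with j<j' ← pairSlot-<-pairSlot (recompute≤ p) (recompute≤ p') (+-cancelˡ-< (blockStart k) _ _ s<t)
  with m≤n⇒m<n∨m≡n (recompute≤ p')
... | inj₁ j'<k = same-column p p' j<j' j'<k
... | inj₂ refl = column-< (subst₂ _<_ (sym (column-two-< {p = p} j<j')) (sym (column-two-diag j' {p'})) (m<n+m (3 * j') {2} z<s))

column-order : ∀ {s t} → NonEmpty s → NonEmpty t → rank s < rank t → ColumnOrder s t
column-order {s} {t} nes net s<t with <-cmp (lastE s) (lastE t)
... | tri< lt _ _ = column-< (≤-<-trans (column-≤ s) (<-≤-trans (m<n⇒2+3m<3n lt) (3*lastE-≤-column net)))
... | tri≈ _ eq _ = column-order-in-block nes net eq s<t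
... | tri> _ _ gt = contradiction s<t (<⇒≯ (rank-<-by-lastE t nes gt))

record Cut : Set where
  field
    size          : ℕ
    bound         : ℕ
    kept-bounded  : ∀ s → rank s < size → lastE s ≤ bound

module Embedding (C : Cut) (F : IncreasingAbove (Cut.bound C)) where
  open Cut C

  Kept : NSeq → Set
  Kept s = rank s < size

  kept-prefix : ∀ {j k} .(p : j ≤ k) → Kept (two j k p) → Kept (one j)
  kept-prefix {j} {k} p = <-trans (rank-one<two j k p)

  relabel : NSeq → ℕ
  relabel s with rank s <? size
  ... | yes _ = lastE s
  ... | no  _ = seq F (column s)

  relabel-kept : ∀ {s} → Kept s → relabel s ≡ lastE s
  relabel-kept {s} kept with rank s <? size
  ... | yes _   = refl
  ... | no  new = contradiction kept new

  relabel-new : ∀ {s} → ¬ Kept s → relabel s ≡ seq F (column s)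
  relabel-new {s} new with rank s <? size
  ... | yes kept = contradiction kept new
  ... | no  _    = refl

  node : ℕ → ℕ
  node j = relabel (one j)

  by-kept : ∀ {P : Set} s → (Kept s → P) → (¬ Kept s → P) → P
  by-kept s if-kept if-new with rank s <? size
  ... | yes kept = if-kept kept
  ... | no  new  = if-new new

  node-< : ∀ j {c} → column (one j) < c → node j < seq F c
  node-< j {c} lt = by-kept (one j)
    (λ kept → subst (_< seq F c) (sym (relabel-kept kept)) (≤-<-trans (kept-bounded (one j) kept) (seq-above F c)))
    (λ new  → subst (_< seq F c) (sym (relabel-new new)) (increasing-< (increasing F) lt))

  node≤relabel : ∀ j k .(p : j ≤ k) → node j ≤ relabel (two j k p)
  node≤relabel j k p = by-kept (two j k p)
    (λ kept → subst₂ _≤_ (sym (relabel-kept (kept-prefix p kept))) (sym (relabel-kept kept)) (recompute≤ p))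
    (λ new  → subst (node j ≤_) (sym (relabel-new new)) (<⇒≤ (node-< j (column-one<two p))))

  node<relabel : ∀ {j k} .(p : j ≤ k) → j < k → node j < relabel (two j k p)
  node<relabel {j} {k} p j<k = by-kept (two j k p)
    (λ kept → subst₂ _<_ (sym (relabel-kept (kept-prefix p kept))) (sym (relabel-kept kept)) j<k)
    (λ new  → subst (node j <_) (sym (relabel-new new)) (node-< j (column-one<two p)))

  node-increasing : ∀ {j j'} → j < j' → node j < node j'
  node-increasing {j} {j'} j<j' = by-kept (one j')
    (λ kept → subst₂ _<_ (sym (relabel-kept (<-trans (rank-<-by-lastE (one j) (one-nonempty j') j<j') kept)))
                          (sym (relabel-kept kept)) j<j')
    (λ new  → subst (node j <_) (sym (relabel-new new)) (node-< j (s≤s (*-monoʳ-< 3 j<j'))))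

  node-injective : ∀ {j j'} → node j ≡ node j' → j ≡ j'
  node-injective {j} {j'} eq with <-cmp j j'
  ... | tri< j<j' _ _ = contradiction eq (<⇒≢ (node-increasing j<j'))
  ... | tri≈ _ j≡j' _ = j≡j'
  ... | tri> _ _ j>j' = contradiction (sym eq) (<⇒≢ (node-increasing j>j'))

  embed : NSeq → NSeq
  embed ε           = ε
  embed (one k)     = one (node k)
  embed (two j k p) = two (node j) (relabel (two j k p)) (node≤relabel j k p)

  embed-kept : ∀ {s} → Kept s → embed s ≡ s
  embed-kept {ε}         _    = refl
  embed-kept {one k}     kept = cong one (relabel-kept kept)
  embed-kept {two j k p} kept = two-cong (relabel-kept (kept-prefix p kept)) (relabel-kept kept)

  embed-nonempty : ∀ {s} → NonEmpty s → NonEmpty (embed s)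
  embed-nonempty (one-nonempty k)     = one-nonempty (node k)
  embed-nonempty (two-nonempty j k p) = two-nonempty (node j) _ (node≤relabel j k p)

  len-embed : ∀ s → len (embed s) ≡ len s
  len-embed ε           = refl
  len-embed (one _)     = refl
  len-embed (two _ _ _) = refl

  embed-prefix : ∀ s t → ProperPrefix s t → ProperPrefix (embed s) (embed t)
  embed-prefix ε           (one k)      _               = node k , [] , refl
  embed-prefix ε           (two j k p)  _               = node j , relabel (two j k p) ∷ [] , refl
  embed-prefix (one j)     (two .j k p) (_ , [] , refl) = relabel (two j k p) , [] , refl
  embed-prefix ε           ε            (_ , _ , ())
  embed-prefix (one _)     ε            (_ , _ , ())
  embed-prefix (one _)     (one _)      (_ , _ , ())
  embed-prefix (one _)     (two _ _ _)  (_ , _ ∷ _ , ())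
  embed-prefix (two _ _ _) ε            (_ , _ , ())
  embed-prefix (two _ _ _) (one _)      (_ , _ , ())
  embed-prefix (two _ _ _) (two _ _ _)  (_ , _ , ())

  embed-prefix⁻ : ∀ s t → ProperPrefix (embed s) (embed t) → ProperPrefix s t
  embed-prefix⁻ ε           (one k)      _               = k , [] , refl
  embed-prefix⁻ ε           (two j k p)  _               = j , k ∷ [] , refl
  embed-prefix⁻ (one j)     (two j' k p) (_ , [] , eq) with refl ← node-injective (cong head eq) = k , [] , refl
  embed-prefix⁻ ε           ε            (_ , _ , ())
  embed-prefix⁻ (one _)     ε            (_ , _ , ())
  embed-prefix⁻ (one _)     (one _)      (_ , _ , ())
  embed-prefix⁻ (one _)     (two _ _ _)  (_ , _ ∷ _ , ())
  embed-prefix⁻ (two _ _ _) ε            (_ , _ , ())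
  embed-prefix⁻ (two _ _ _) (one _)      (_ , _ , ())
  embed-prefix⁻ (two _ _ _) (two _ _ _)  (_ , _ , ())

  lastE-embed : ∀ {s} → NonEmpty s → lastE (embed s) ≡ relabel s
  lastE-embed (one-nonempty _)     = refl
  lastE-embed (two-nonempty _ _ _) = refl

  embed-<-by-relabel : ∀ {s t} → NonEmpty s → NonEmpty t → relabel s < relabel t → rank (embed s) < rank (embed t)
  embed-<-by-relabel {s} nes net lt =
    rank-<-by-lastE (embed s) (embed-nonempty net) (subst₂ _<_ (sym (lastE-embed nes)) (sym (lastE-embed net)) lt)

  embed-rank-<-new : ∀ {s t} → NonEmpty s → NonEmpty t → ¬ Kept s → ¬ Kept t → rank s < rank t →
    rank (embed s) < rank (embed t)
  embed-rank-<-new {s} {t} nes net s-new t-new s<t with column-order nes net s<t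
  ... | column-< lt = embed-<-by-relabel {s} {t} nes net
          (subst₂ _<_ (sym (relabel-new s-new)) (sym (relabel-new t-new)) (increasing-< (increasing F) lt))
  ... | same-column {j} {j'} {k} p p' j<j' j'<k = begin-strict
    blockStart ℓ + pairSlot (node j) ℓ   ≡⟨ cong (blockStart ℓ +_) (pairSlot-< (node<relabel p (<-trans j<j' j'<k))) ⟩
    blockStart ℓ + node j                  <⟨ +-monoʳ-< (blockStart ℓ) (node-increasing j<j') ⟩
    blockStart ℓ + node j'                 ≡⟨ cong (λ m → blockStart m + node j') same-ℓ ⟩
    blockStart ℓ' + node j'                ≡⟨ cong (blockStart ℓ' +_) (pairSlot-< (node<relabel p' j'<k)) ⟨
    blockStart ℓ' + pairSlot (node j') ℓ' ∎
    where
    open ≤-Reasoning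
    ℓ  = relabel (two j k p)
    ℓ' = relabel (two j' k p')
    same-ℓ : ℓ ≡ ℓ'
    same-ℓ = trans (relabel-new s-new)
                     (trans (cong (seq F) (trans (column-two-< {p = p} (<-trans j<j' j'<k)) (sym (column-two-< {p = p'} j'<k))))
                            (sym (relabel-new t-new)))

  embed-rank-< : ∀ {s t} → NonEmpty s → rank s < rank t → rank (embed s) < rank (embed t)
  embed-rank-< {s} {t} nes s<t = by-kept t
    (λ t-kept → subst₂ (λ u v → rank u < rank v)
                       (sym (embed-kept {s} (<-trans s<t t-kept))) (sym (embed-kept {t} t-kept)) s<t)
    (λ t-new → by-kept s
      (λ s-kept → embed-<-by-relabel {s} {t} nes net
        (subst₂ _<_ (sym (relabel-kept s-kept)) (sym (relabel-new t-new))
                (≤-<-trans (kept-bounded s s-kept) (seq-above F (column t)))))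
      (λ s-new → embed-rank-<-new {s} {t} nes net s-new t-new s<t))
    where
    net : NonEmpty t
    net = nonempty-of-rank (≤-<-trans z≤n s<t)

  thin : E2Tree → E2Tree
  thin X = record
    { fun   = fun X ∘ embed
    ; inW   = inW X ∘ embed
    ; lenOK = λ s → trans (lenOK X (embed s)) (len-embed s)
    ; incr  = λ m 0<m → top-increasing X {embed (jvec m)} {embed (jvec (suc m))} (embed-nonempty (jvec-nonempty 0<m))
                          (embed-rank-< {jvec m} {jvec (suc m)} (jvec-nonempty 0<m)
                             (subst₂ _<_ (sym (rank-jvec m)) (sym (rank-jvec (suc m))) (n<1+n m)))
    ; segTo = λ s t seg → embed-prefix⁻ s t (segTo X (embed s) (embed t) seg)
    ; segFr = λ s t pre → segFr X (embed s) (embed t) (embed-prefix s t pre)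
    }

  thin-≤ : ∀ X → thin X ≤E X
  thin-≤ X p with ivec-view p
  ... | ivec≡two j k q ivec≡ _ =
    triangle (relabel (two j k q)) + node j ,
    cong (fun X) (trans (cong embed ivec≡) (sym (ivec-pairRank (node j) (relabel (two j k q)) (node≤relabel j k q))))

  thin-kept : ∀ X {p} → Kept (ivec p) → at (thin X) p ≡ at X p
  thin-kept X kept = cong (fun X) (embed-kept kept)

-- Finite approximations

length-r : ∀ n X → length (r n X) ≡ n
length-r n X = trans (length-map (at X) (upTo n)) (length-upTo n)

r-suc : ∀ n X → r (suc n) X ≡ r n X ∷ʳ at X n
r-suc n X = trans (cong (map (at X)) (sym (upTo-∷ʳ n))) (map-++ (at X) (upTo n) [ n ])

∈-r⁻ : ∀ {x} n X → x ∈ r n X → ∃[ q ] q < n × x ≡ at X q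
∈-r⁻ n X x∈ = let q , q∈ , x≡ = ∈-map⁻ (at X) x∈ in q , ∈-upTo⁻ q∈ , x≡

at-∈-r : ∀ {q} n X → q < n → at X q ∈ r n X
at-∈-r n X q<n = ∈-map⁺ (at X) (∈-upTo⁺ q<n)

r-cong : ∀ n {X Y} → (∀ {q} → q < n → at X q ≡ at Y q) → r n X ≡ r n Y
r-cong zero    _  = refl
r-cong (suc n) {X} {Y} eq = begin
  r (suc n) X           ≡⟨ r-suc n X ⟩
  r n X ∷ʳ at X n       ≡⟨ cong₂ _∷ʳ_ (r-cong n {X} {Y} λ q<n → eq (m<n⇒m<1+n q<n)) (eq (n<1+n n)) ⟩
  r n Y ∷ʳ at Y n       ≡⟨ r-suc n Y ⟨
  r (suc n) Y           ∎
  where open ≡-Reasoning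

r-≡⇒at-≡ : ∀ n {X Y q} → r n X ≡ r n Y → q < n → at X q ≡ at Y q
r-≡⇒at-≡ (suc n) {X} {Y} {q} eq q<sn
  with rX≡rY , atX≡atY ← ∷ʳ-injective (r n X) (r n Y) (trans (sym (r-suc n X)) (trans eq (r-suc n Y)))
  with m≤n⇒m<n∨m≡n (s≤s⁻¹ q<sn)
... | inj₁ q<n  = r-≡⇒at-≡ n {X} {Y} rX≡rY q<n
... | inj₂ refl = atX≡atY

take-length-++ : ∀ {A : Set} (xs ys : List A) → take (length xs) (xs ++ ys) ≡ xs
take-length-++ []       ys = refl
take-length-++ (x ∷ xs) ys = cong (x ∷_) (take-length-++ xs ys)

InR-extension : ∀ {n a Y b} Z₀ → a ≡ r n Z₀ → InR (suc n) a Y b →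
  Σ E2Tree λ Z → r n Z ≡ a × b ≡ a ++ [ at Z n ] × at Z n ∈E Y
InR-extension {n} {a} {Y} {b} Z₀ a≡r ((Z , b≡r) , (m , m<len , a≡take) , b⊆Y) =
  Z , sym a≡rZ , b≡ , All.head (++⁻ʳ a (subst (All (_∈E Y)) b≡ b⊆Y))
  where
  m≡n : m ≡ n
  m≡n = begin
    m                      ≡⟨ m≤n⇒m⊓n≡m (<⇒≤ m<len) ⟨
    m ⊓ length b           ≡⟨ length-take m b ⟨
    length (take m b)      ≡⟨ cong length a≡take ⟨
    length a               ≡⟨ cong length a≡r ⟩
    length (r n Z₀)        ≡⟨ length-r n Z₀ ⟩
    n                      ∎
    where open ≡-Reasoning
  a≡rZ : a ≡ r n Z
  a≡rZ = begin
    a                                   ≡⟨ a≡take ⟩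
    take m b                            ≡⟨ cong₂ take m≡n (trans b≡r (r-suc n Z)) ⟩
    take n (r n Z ++ [ at Z n ])        ≡⟨ cong (λ l → take l (r n Z ++ [ at Z n ])) (length-r n Z) ⟨
    take (length (r n Z)) (r n Z ++ _)  ≡⟨ take-length-++ (r n Z) [ at Z n ] ⟩
    r n Z                               ∎
    where open ≡-Reasoning
  b≡ : b ≡ a ++ [ at Z n ]
  b≡ = trans b≡r (trans (r-suc n Z) (cong (_∷ʳ at Z n) (sym a≡rZ)))

depth-last : ∀ {X a d} → IsDepth X a (suc d) → at X d ∈ a
depth-last {X} {a} {d} (a⊆r , least) with at X d ∈? a
... | yes ∈a = ∈a
... | no  ∉a = contradiction (least d a⊆shorter) (n≮n d)
  where
  a⊆shorter : a ⊆L r d X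
  a⊆shorter = All.tabulate λ {x} x∈a → case (∈-++⁻ (r d X) (subst (x ∈_) (r-suc d X) (All.lookup a⊆r x∈a))) x∈a
    where
    case : ∀ {x} → x ∈ r d X ⊎ x ∈ [ at X d ] → x ∈ a → x ∈ r d X
    case (inj₁ x∈) _ = x∈
    case (inj₂ (here refl)) x∈a = contradiction x∈a ∉a

-- Everything up to the last sequence listed in r_d(X) is kept; its X-values lie below those of a.
record DepthCut (X : E2Tree) (a : List (List ℕ)) (d : ℕ) : Set where
  field
    cut         : Cut
    a-recorded  : a ⊆L r d X
    prefix-kept : ∀ {q} → q < d → rank (ivec q) < Cut.size cut
    kept-below  : ∀ {v} → (∀ x → x ∈ a → maxL x < v) → ∀ {s} → NonEmpty s → rank s < Cut.size cut → top X s < v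

depth-cut : ∀ {X a d} → IsDepth X a d → DepthCut X a d
depth-cut {d = zero} depth = record
  { cut = record
    { size = 1 ; bound = 0
    ; kept-bounded = λ s rank<1 → ≤-reflexive (cong lastE (rank≡0 {s} (n<1⇒n≡0 rank<1)))
    }
  ; a-recorded  = proj₁ depth
  ; prefix-kept = λ ()
  ; kept-below  = λ _ ne rank<1 → contradiction (s≤s⁻¹ rank<1) (<⇒≱ (rank-positive ne))
  }
depth-cut {X} {a} {suc d} depth = record
  { cut = record
    { size = suc (rank s₀) ; bound = lastE s₀
    ; kept-bounded = λ s rank≤ → lastE-monotone {s} {s₀} (s≤s⁻¹ rank≤)
    }
  ; a-recorded  = proj₁ depth
  ; prefix-kept = prefix-kept
  ; kept-below  = λ above {s} ne rank≤ →
      ≤-<-trans (top-monotone X {s} {s₀} ne (s≤s⁻¹ rank≤)) (above (at X d) (depth-last {X} {a} {d} depth))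
  }
  where
  s₀ = ivec d
  prefix-kept : ∀ {q} → q < suc d → rank (ivec q) < suc (rank s₀)
  prefix-kept q<sd with m≤n⇒m<n∨m≡n (s≤s⁻¹ q<sd)
  ... | inj₁ q<d  = s≤s (<⇒≤ (rank-ivec-< q<d))
  ... | inj₂ refl = ≤-refl

head-at : ∀ Z q {j k} .{p : j ≤ k} → ivec q ≡ two j k p → head (at Z q) ≡ top Z (one j)
head-at Z q {j} {k} {p} ivec≡ = trans (cong (head ∘ fun Z) ivec≡) (head-pair Z j k p)

-- Homogeneous thinnings for the one-step extensions of a

module Extension (em : ExcludedMiddle 0ℓ) (H : List (List ℕ) → Set) (X : E2Tree)
                 {n a} (Z₀ : E2Tree) (a≡r : a ≡ r n Z₀) {d} (D : DepthCut X a d) where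
  open DepthCut D
  open Cut cut

  Decided : E2Tree → Set
  Decided Y = (∀ b → InR (suc n) a Y b → H b) ⊎ (∀ b → InR (suc n) a Y b → ¬ H b)

  DecidingThinning : Set
  DecidingThinning = Σ E2Tree λ Y → Y ∈[ r d X , X ] × Decided Y

  colour : List ℕ → Bool
  colour y = does (em {H (a ++ [ y ])})

  colour-true : ∀ {y} → colour y ≡ true → H (a ++ [ y ])
  colour-true {y} eq with em {H (a ++ [ y ])}
  ... | yes h = h

  colour-false : ∀ {y} → colour y ≡ false → ¬ H (a ++ [ y ])
  colour-false {y} eq with em {H (a ++ [ y ])}
  ... | no ¬h = ¬h

  decided-by-colour : ∀ Y (V : List ℕ → Set) c →
    (∀ Z → r n Z ≡ a → V (at Z n)) → (∀ {y} → y ∈E Y → V y → colour y ≡ c) → Decided Y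
  decided-by-colour Y V true  V-ext homogeneous = inj₁ λ b inR →
    let Z , rZ≡a , b≡ , y∈Y = InR-extension {Y = Y} {b = b} Z₀ a≡r inR
    in subst H (sym b≡) (colour-true (homogeneous y∈Y (V-ext Z rZ≡a)))
  decided-by-colour Y V false V-ext homogeneous = inj₂ λ b inR Hb →
    let Z , rZ≡a , b≡ , y∈Y = InR-extension {Y = Y} {b = b} Z₀ a≡r inR
    in colour-false (homogeneous y∈Y (V-ext Z rZ≡a)) (subst H b≡ Hb)

  pairColour : ℕ → ℕ → Bool
  pairColour u w with u ≤? w
  ... | yes u≤w = colour (fun X (two u w u≤w))
  ... | no  _   = false

  pairColour-two : ∀ {u w} .(p : u ≤ w) → colour (fun X (two u w p)) ≡ pairColour u w
  pairColour-two {u} {w} p with u ≤? w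
  ... | yes _   = refl
  ... | no  u≰w = ⊥-elim-irr (u≰w p)

  kept-below-extension : ∀ {Z v} → r n Z ≡ a → (∀ {q} → q < n → top Z (ivec q) < v) →
    ∀ {s} → NonEmpty s → rank s < size → top X s < v
  kept-below-extension {Z} {v} rZ≡a below = kept-below λ x x∈a →
    let q , q<n , x≡ = ∈-r⁻ n Z (subst (x ∈_) (sym rZ≡a) x∈a) in subst (λ x → maxL x < v) (sym x≡) (below q<n)

  module Thinned (F : IncreasingAbove bound) where
    open Embedding cut F public

    thin-∈-box : thin X ∈[ r d X , X ]
    thin-∈-box = thin-≤ X , d , r-cong d {thin X} {X} (λ {q} q<d → thin-kept X {q} (prefix-kept q<d))

    thin-element : ∀ {y} → y ∈E thin X → ∃[ j ] ∃[ k ] Σ (j ≤ k) λ p → y ≡ fun X (embed (two j k p))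
    thin-element {y} (q , y≡) with ivec-view q
    ... | ivec≡two j k p ivec≡ _ = j , k , p , trans y≡ (cong (fun X ∘ embed) ivec≡)

  -- For every extension Z of a, the X-value of (j) is read off a's entry for (j,j),
  -- which a has recorded from X as the value of some (u,v).
  anchor : ∀ j → triangle j + j < n → ∃[ u ] (∀ {Z} → r n Z ≡ a → top Z (one j) ≡ top X (one u))
  anchor j q₁<n with ∈-r⁻ d X (All.lookup a-recorded (subst (at Z₀ (triangle j + j) ∈_) (sym a≡r) (at-∈-r n Z₀ q₁<n)))
  ... | q₂ , q₂<d , at≡ with ivec-view q₂
  ... | ivec≡two u v p ivec≡ _ = u , λ {Z} rZ≡a → begin
    top Z (one j)                 ≡⟨ head-at Z (triangle j + j) (ivec-pairRank j j ≤-refl) ⟨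
    head (at Z (triangle j + j))  ≡⟨ cong head (r-≡⇒at-≡ n {Z} {Z₀} (trans rZ≡a a≡r) q₁<n) ⟩
    head (at Z₀ (triangle j + j)) ≡⟨ cong head at≡ ⟩
    head (at X q₂)                ≡⟨ head-at X q₂ ivec≡ ⟩
    top X (one u)                 ∎
    where open ≡-Reasoning

  module OffDiagonal {j k} .{p : j ≤ k} (ivec≡ : ivec n ≡ two j k p) (n≡ : triangle k + j ≡ n) (j<k : j < k) where
    anchor-of-j = anchor j (subst (triangle j + j <_) n≡ (pairRank-<-by-snd {j' = j} ≤-refl j<k))
    u = proj₁ anchor-of-j
    anchored : ∀ {Z} → r n Z ≡ a → top Z (one j) ≡ top X (one u)
    anchored {Z} = proj₂ anchor-of-j {Z}

    homogeneous = homogeneous-sequence em (pairColour u) bound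
    F = proj₁ homogeneous
    c = proj₁ (proj₂ homogeneous)
    open Thinned F

    Fresh : List ℕ → Set
    Fresh y = head y ≡ top X (one u) × (∀ {s} → NonEmpty s → Kept s → top X s < maxL y)

    extension-fresh : ∀ Z → r n Z ≡ a → Fresh (at Z n)
    extension-fresh Z rZ≡a =
      trans (head-at Z n ivec≡) (anchored {Z} rZ≡a) ,
      kept-below-extension {Z} rZ≡a λ {q} q<n → top-increasing Z {ivec q} {ivec n} (ivec-nonempty q) (rank-ivec-< q<n)

    fresh-pair-colour : ∀ {y} j k (p : j ≤ k) → y ≡ fun X (embed (two j k p)) → Fresh y → colour y ≡ c
    fresh-pair-colour {y} j k p y≡ (head≡ , above-kept) = begin
      colour y                                               ≡⟨ cong colour (trans y≡ (cong (fun X) (two-cong node≡u relabel≡))) ⟩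
      colour (fun X (two u (seq F (column (two j k p))) u≤)) ≡⟨ pairColour-two u≤ ⟩
      pairColour u (seq F (column (two j k p)))              ≡⟨ proj₂ (proj₂ homogeneous) (column (two j k p)) ⟩
      c                                                      ∎
      where
      open ≡-Reasoning
      node≡u : node j ≡ u
      node≡u = top-one-injective X (trans (sym (head-pair X (node j) (relabel (two j k p)) (node≤relabel j k p)))
                                          (trans (cong head (sym y≡)) head≡))
      pair-new : ¬ Kept (two j k p)
      pair-new kept = <-irrefl (cong maxL (sym (trans y≡ (cong (fun X) (embed-kept {two j k p} kept)))))
                               (above-kept (two-nonempty j k p) kept)
      relabel≡ : relabel (two j k p) ≡ seq F (column (two j k p))
      relabel≡ = relabel-new pair-new
      u≤ : u ≤ seq F (column (two j k p))
      u≤ = subst₂ _≤_ node≡u relabel≡ (node≤relabel j k p)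

    fresh-colour : ∀ {y} → y ∈E thin X → Fresh y → colour y ≡ c
    fresh-colour y∈ = let j , k , p , y≡ = thin-element y∈ in fresh-pair-colour j k p y≡

    thinning : DecidingThinning
    thinning = thin X , thin-∈-box , decided-by-colour (thin X) Fresh c extension-fresh fresh-colour

  module Diagonal {k} .{p : k ≤ k} (ivec≡ : ivec n ≡ two k k p) (n≡ : triangle k + k ≡ n) where
    homogeneous = ramsey em pairColour bound
    F = proj₁ homogeneous
    c = proj₁ (proj₂ homogeneous)
    open Thinned F

    Fresh : List ℕ → Set
    Fresh y = ∀ {s} → NonEmpty s → Kept s → top X s < head y

    extension-fresh : ∀ Z → r n Z ≡ a → Fresh (at Z n)
    extension-fresh Z rZ≡a {s} ne kept =
      subst (top X s <_) (sym (head-at Z n ivec≡))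
        (kept-below-extension {Z} rZ≡a (λ {q} q<n → top-increasing Z {ivec q} {one k} (ivec-nonempty q)
                                         (rank-ivec-<-rank-one {q} {k} (subst (q <_) (sym n≡) q<n))) ne kept)

    fresh-pair-colour : ∀ {y} j k (p : j ≤ k) → y ≡ fun X (embed (two j k p)) → Fresh y → colour y ≡ c
    fresh-pair-colour {y} j k p y≡ above-kept = begin
      colour y                                                         ≡⟨ cong colour (trans y≡ (cong (fun X) (two-cong node≡ relabel≡))) ⟩
      colour (fun X (two (seq F (column (one j))) (seq F (column (two j k p))) F≤F)) ≡⟨ pairColour-two F≤F ⟩
      pairColour (seq F (column (one j))) (seq F (column (two j k p)))    ≡⟨ proj₂ (proj₂ homogeneous) (column-one<two p) ⟩
      c                                                                ∎
      where
      open ≡-Reasoning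
      node-new : ¬ Kept (one (node j))
      node-new kept = <-irrefl (trans (sym (head-pair X (node j) (relabel (two j k p)) (node≤relabel j k p))) (cong head (sym y≡)))
                               (above-kept (one-nonempty (node j)) kept)
      j-new : ¬ Kept (one j)
      j-new kept = node-new (subst (λ m → Kept (one m)) (sym (relabel-kept {one j} kept)) kept)
      node≡ : node j ≡ seq F (column (one j))
      node≡ = relabel-new j-new
      relabel≡ : relabel (two j k p) ≡ seq F (column (two j k p))
      relabel≡ = relabel-new (j-new ∘ kept-prefix p)
      F≤F : seq F (column (one j)) ≤ seq F (column (two j k p))
      F≤F = <⇒≤ (increasing-< (increasing F) (column-one<two p))

    fresh-colour : ∀ {y} → y ∈E thin X → Fresh y → colour y ≡ c
    fresh-colour y∈ = let j , k , p , y≡ = thin-element y∈ in fresh-pair-colour j k p y≡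

    thinning : DecidingThinning
    thinning = thin X , thin-∈-box , decided-by-colour (thin X) Fresh c extension-fresh fresh-colour

  thinning : DecidingThinning
  thinning with ivec-view n
  ... | ivec≡two j k j≤k ivec≡ n≡ with m≤n⇒m<n∨m≡n j≤k
  ...   | inj₁ j<k  = OffDiagonal.thinning ivec≡ n≡ j<k
  ...   | inj₂ refl = Diagonal.thinning ivec≡ n≡

lemma17 : ExcludedMiddle 0ℓ →
    (n : ℕ) (a : List (List ℕ)) (X : E2Tree) →
    AR n a → a ⊆E X →
    (H : List (List ℕ) → Set) → (∀ b → H b → AR (suc n) b) →
    (d : ℕ) → IsDepth X a d →
    Σ E2Tree λ Y → Y ∈[ r d X , X ] ×
    ((∀ b → InR (suc n) a Y b → H b) ⊎ (∀ b → InR (suc n) a Y b → ¬ H b))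
lemma17 em n a X (Z₀ , a≡r) _ H _ d depth = Extension.thinning em H X Z₀ a≡r (depth-cut depth)
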